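{- For $n\ge 3$, let $f_{n-3}\colon\{0,1\}^n\to\{0,1,\perp\}$ be given by $f_{n-3}(x)=0$ if $|x|\le n-3$, $f_{n-3}(x)=\perp$ if $n-2\le|x|\le n-1$, $f_{n-3}(x)=1$ if $|x|=n$, and $F_{n-3}(x,y)=f_{n-3}(x\oplus y)$. Then $\mathrm{D_{cc}^{\rightarrow}}(F_{n-3})\le n-\Theta(\log n)$, whereas $\mathrm{NADT^{\oplus}}(f_{n-3})=n-2$. The number of inputs on which $f_{n-3}$ is undefined is $\frac{n(n+1)}{2}$.
   Context: $|x|$ is Hamming weight, $\oplus$ is bitwise XOR. $\operatorname{Dom}(f)=f^{ -1}(\{0,1\})$, $\operatorname{Dom}(F)=\{(x,y):x\oplus y\in\operatorname{Dom}(f)\}$. $\mathrm{D_{cc}^{\rightarrow}}(F)$ is the minimum $t$ such that there are total $h\colon\{0,1\}^n\to\{0,1\}^t$ and $\varphi\colon\{0,1\}^t\times\{0,1\}^n\to\{0,1\}$ with $\varphi(h(x),y)=F(x,y)$ for all $(x,y)\in\operatorname{Dom}(F)$. With $\langle s,x\rangle=\bigoplus_is_i\wedge x_i$, $\mathrm{NADT^{\oplus}}(f)$ is the minimum $p$ such that there are $s_1,\dots,s_p\in\{0,1\}^n$ and total $l\colon\{0,1\}^p\to\{0,1\}$ with $l(\langle s_1,x\rangle,\dots,\langle s_p,x\rangle)=f(x)$ for all $x\in\operatorname{Dom}(f)$. The bound $n-\Theta(\log n)$ means $n-g(n)$ for some $g(n)=\Theta(\log n)$ as $n\to\infty$. 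-}

module Defs where

open import Data.Bool using (Bool; true; false; _∧_; _xor_; if_then_else_)
open import Data.Nat using (ℕ; zero; suc; _+_; _*_; _∸_; _≤_; _≤ᵇ_; _≡ᵇ_)
open import Data.Nat.Logarithm using (⌊log₂_⌋)
open import Data.Vec using (Vec; []; _∷_; zipWith; foldr; map)
open import Data.List using (List; []; _∷_; _++_; length; filter)
import Data.List as List
open import Data.Maybe using (Maybe; just; nothing; is-nothing)
open import Data.Product using (Σ; _×_; ∃)
open import Relation.Binary.PropositionalEquality using (_≡_)
open import Data.Bool using (T)

Bits : ℕ → Set
Bits n = Vec Bool n

-- partial Boolean function: nothing = ⊥ (undefined)
PartialFn : ℕ → Set
PartialFn n = Bits n → Maybe Bool

PartialFn₂ : ℕ → Set
PartialFn₂ n = Bits n → Bits n → Maybe Bool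

weight : ∀ {n} → Bits n → ℕ
weight = foldr (λ _ → ℕ) (λ b w → (if b then 1 else 0) + w) 0

_⊕_ : ∀ {n} → Bits n → Bits n → Bits n
_⊕_ = zipWith _xor_

⟨_,_⟩ : ∀ {n} → Bits n → Bits n → Bool
⟨ s , x ⟩ = foldr (λ _ → Bool) _xor_ false (zipWith _∧_ s x)

f : (n : ℕ) → PartialFn n
f n x = if weight x ≤ᵇ (n ∸ 3) then just false
        else (if weight x ≡ᵇ n then just true else nothing)

F : (n : ℕ) → PartialFn₂ n
F n x y = f n (x ⊕ y)

OneWayProtocol : ∀ {n} → PartialFn₂ n → ℕ → Set
OneWayProtocol {n} G t =
  Σ (Bits n → Bits t) λ h → Σ (Bits t → Bits n → Bool) λ φ →
    ∀ x y b → G x y ≡ just b → φ (h x) y ≡ b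

IsDcc : ∀ {n} → PartialFn₂ n → ℕ → Set
IsDcc G d = OneWayProtocol G d × (∀ t → OneWayProtocol G t → d ≤ t)

NAParityDT : ∀ {n} → PartialFn n → ℕ → Set
NAParityDT {n} g p =
  Σ (Vec (Bits n) p) λ ss → Σ (Bits p → Bool) λ l →
    ∀ x b → g x ≡ just b → l (map (λ s → ⟨ s , x ⟩) ss) ≡ b

IsNADT : ∀ {n} → PartialFn n → ℕ → Set
IsNADT g p = NAParityDT g p × (∀ q → NAParityDT g q → p ≤ q)

IsΘlog : (ℕ → ℕ) → Set
IsΘlog g = Σ ℕ λ a → Σ ℕ λ b → Σ ℕ λ N →
  ∀ n → N ≤ n → (⌊log₂ n ⌋ ≤ a * g n) × (g n ≤ b * ⌊log₂ n ⌋)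

allBits : (n : ℕ) → List (Bits n)
allBits zero = [] ∷ []
allBits (suc n) = List.map (false ∷_) (allBits n) ++ List.map (true ∷_) (allBits n)

undefCount : ∀ {n} → PartialFn n → ℕ
undefCount {n} g = length (filter (λ x → Data.Bool.T? (is-nothing (g x))) (allBits n))

-- For the protocol bound, Alice sends the index of a codeword within Hamming
-- distance 1 of x, taken from a radius-1 covering code of length n with
-- 2^(n − ⌊log₂ n⌋) codewords (a padded Hamming code), and Bob accepts iff the
-- complement ȳ of y has the same index. F(x, y) = 1 exactly when x = ȳ, while two
-- inputs with the same index are at distance ≤ 2, so then |x ⊕ y| ≥ n − 2 and
-- F(x, y) ≠ 0. The minimal cost exists because correct protocols of a given
-- cost are decidable, by exhausting Alice's message functions.
--
-- Reading the last n − 2 bits and checking that they are all 1 computes f.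
-- Against fewer than n − 2 parity queries, Gaussian elimination yields a common
-- zero y of weight ≥ 3; then ones ⊕ y, where f is 0, and ones, where f is 1,
-- receive the same answers.
--
-- f is undefined exactly on the inputs with one or two zeros, and there are
-- n C 1 + n C 2 = (n + 1) C 2 of them.

module Submission where

open import Algebra.Bundles using (CommutativeRing; CommutativeSemigroup)
import Algebra.Properties.CommutativeSemigroup as CommutativeSemigroupProperties
open import Data.Bool using (Bool; true; false; not; _∧_; _∨_; _xor_; if_then_else_; T; T?)
import Data.Bool.Properties as Bool
open import Data.Bool.Properties
  using (xor-assoc; xor-comm; xor-same; xor-identityˡ; xor-identityʳ; ∧-comm; ∧-distribˡ-xor; xor-∧-commutativeRing)
open import Data.Empty using (⊥; ⊥-elim)
open import Data.List using (List; []; _∷_; length)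
import Data.List as List
import Data.List.Properties as List
open import Data.List.Relation.Binary.Permutation.Propositional using (_↭_; ↭-refl; ↭-trans; ↭-swap; ↭-prep)
open import Data.List.Relation.Binary.Permutation.Propositional.Properties using (All-resp-↭; ↭-length)
open import Data.List.Relation.Unary.All as All using (All; []; _∷_)
open import Data.List.Relation.Unary.All.Properties using (map⁻)
open import Data.Maybe using (just; nothing; is-nothing)
import Data.Maybe.Properties as Maybe
open import Data.Nat
  using (ℕ; zero; suc; _+_; _*_; _^_; _∸_; _/_; _≤_; _<_; z≤n; s≤s; s≤s⁻¹; _≤ᵇ_; _≡ᵇ_; ⌊_/2⌋; ⌈_/2⌉)
open import Data.Nat.Combinatorics using (_C_; nCk+nC[k+1]≡[n+1]C[k+1]; nCk≡nPk/k!)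
open import Data.Nat.Induction using (<-rec)
open import Data.Nat.Logarithm using (⌊log₂_⌋)
open import Data.Nat.Logarithm.Core using (⌊log2⌋)
open import Data.Nat.Properties
open import Data.Product using (Σ; ∃; _×_; _,_; proj₁; proj₂)
open import Data.Sum using (_⊎_; inj₁; inj₂)
open import Data.Vec using (Vec; []; _∷_; _++_; replicate; take; drop; head; tail; toList)
import Data.Vec as Vec
import Data.Vec.Properties as Vec
open import Data.Vec.Properties
  using (zipWith-assoc; zipWith-comm; zipWith-identityˡ; zipWith-identityʳ; zipWith-++; take++drop≡id; ++-injectiveˡ; ++-injectiveʳ; ≡-dec)
open import Function using (case_of_)
open import Induction.WellFounded using (Acc; acc)
open import Relation.Binary.Definitions using (DecidableEquality)
open import Relation.Binary.PropositionalEquality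
open import Relation.Nullary using (¬_; yes; no; does; contradiction)
open import Relation.Nullary.Decidable using (Dec; dec-true; dec-false; ¬?; map′; _⊎-dec_; _→-dec_; decidable-stable)
open import Relation.Unary using (Decidable)

open import Defs

open CommutativeSemigroupProperties (CommutativeRing.+-commutativeSemigroup xor-∧-commutativeRing)
  using () renaming (interchange to xor-interchange)

-- Bit vectors

ones zeros : ∀ n → Bits n
ones n = replicate n true
zeros n = replicate n false

bitWeight : Bool → ℕ
bitWeight b = if b then 1 else 0

⊕-assoc : ∀ {n} (x y z : Bits n) → (x ⊕ y) ⊕ z ≡ x ⊕ (y ⊕ z)
⊕-assoc = zipWith-assoc xor-assoc

⊕-comm : ∀ {n} (x y : Bits n) → x ⊕ y ≡ y ⊕ x
⊕-comm = zipWith-comm xor-comm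

⊕-identityˡ : ∀ {n} (x : Bits n) → zeros n ⊕ x ≡ x
⊕-identityˡ = zipWith-identityˡ xor-identityˡ

⊕-identityʳ : ∀ {n} (x : Bits n) → x ⊕ zeros n ≡ x
⊕-identityʳ = zipWith-identityʳ xor-identityʳ

⊕-self : ∀ {n} (x : Bits n) → x ⊕ x ≡ zeros n
⊕-self [] = refl
⊕-self (b ∷ x) = cong₂ _∷_ (xor-same b) (⊕-self x)

⊕-cancelˡ : ∀ {n} (x y : Bits n) → x ⊕ (x ⊕ y) ≡ y
⊕-cancelˡ {n} x y = begin
  x ⊕ (x ⊕ y)  ≡⟨ ⊕-assoc x x y ⟨
  (x ⊕ x) ⊕ y  ≡⟨ cong (_⊕ y) (⊕-self x) ⟩
  zeros n ⊕ y  ≡⟨ ⊕-identityˡ y ⟩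
  y            ∎
  where open ≡-Reasoning

⊕-cancelʳ : ∀ {n} (x y : Bits n) → (x ⊕ y) ⊕ y ≡ x
⊕-cancelʳ x y = trans (⊕-comm (x ⊕ y) y) (trans (cong (y ⊕_) (⊕-comm x y)) (⊕-cancelˡ y x))

⊕-complement : ∀ {n} (x y : Bits n) → x ⊕ y ≡ ones n → x ≡ ones n ⊕ y
⊕-complement x y eq = trans (sym (⊕-cancelʳ x y)) (cong (_⊕ y) eq)

⊕-commutativeSemigroup : ℕ → CommutativeSemigroup _ _
⊕-commutativeSemigroup n = record
  { _∙_ = _⊕_ {n}
  ; isCommutativeSemigroup = record
    { isSemigroup = record { isMagma = isMagma _⊕_ ; assoc = ⊕-assoc }
    ; comm = ⊕-comm
    }
  }

⊕-shift : ∀ {n} (a b c d : Bits n) → b ⊕ ((a ⊕ d) ⊕ c) ≡ ((a ⊕ b) ⊕ c) ⊕ d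
⊕-shift {n} a b c d = begin
  b ⊕ ((a ⊕ d) ⊕ c)  ≡⟨ cong (b ⊕_) (xy∙z≈xz∙y a d c) ⟩
  b ⊕ ((a ⊕ c) ⊕ d)  ≡⟨ ⊕-assoc b (a ⊕ c) d ⟨
  (b ⊕ (a ⊕ c)) ⊕ d  ≡⟨ cong (_⊕ d) (x∙yz≈yx∙z b a c) ⟩
  ((a ⊕ b) ⊕ c) ⊕ d  ∎
  where
  open ≡-Reasoning
  open CommutativeSemigroupProperties (⊕-commutativeSemigroup n) using (xy∙z≈xz∙y; x∙yz≈yx∙z)

_≟ᴮ_ : ∀ {t} → DecidableEquality (Bits t)
_≟ᴮ_ = ≡-dec Bool._≟_

weight-zeros : ∀ n → weight (zeros n) ≡ 0
weight-zeros zero = refl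
weight-zeros (suc n) = weight-zeros n

weight-ones : ∀ n → weight (ones n) ≡ n
weight-ones zero = refl
weight-ones (suc n) = cong suc (weight-ones n)

weight-≤ : ∀ {n} (x : Bits n) → weight x ≤ n
weight-≤ [] = z≤n
weight-≤ (false ∷ x) = m≤n⇒m≤1+n (weight-≤ x)
weight-≤ (true ∷ x) = s≤s (weight-≤ x)

weight≡n⇒ones : ∀ {n} (x : Bits n) → weight x ≡ n → x ≡ ones n
weight≡n⇒ones [] _ = refl
weight≡n⇒ones (true ∷ x) eq = cong (true ∷_) (weight≡n⇒ones x (suc-injective eq))
weight≡n⇒ones {suc n} (false ∷ x) eq = contradiction (subst (_≤ n) eq (weight-≤ x)) 1+n≰n

weight-++ : ∀ {m k} (x : Bits m) (y : Bits k) → weight (x ++ y) ≡ weight x + weight y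
weight-++ [] y = refl
weight-++ (b ∷ x) y = trans (cong (bitWeight b +_) (weight-++ x y)) (sym (+-assoc (bitWeight b) _ _))

weight-complement : ∀ {n} (x : Bits n) → weight x + weight (ones n ⊕ x) ≡ n
weight-complement [] = refl
weight-complement (false ∷ x) = trans (+-suc _ _) (cong suc (weight-complement x))
weight-complement (true ∷ x) = cong suc (weight-complement x)

weight-⊕-≤ : ∀ {n} (x y : Bits n) → weight (x ⊕ y) ≤ weight x + weight y
weight-⊕-≤ [] [] = z≤n
weight-⊕-≤ (false ∷ x) (false ∷ y) = weight-⊕-≤ x y
weight-⊕-≤ (false ∷ x) (true ∷ y) =
  subst (suc (weight (x ⊕ y)) ≤_) (sym (+-suc (weight x) (weight y))) (s≤s (weight-⊕-≤ x y))
weight-⊕-≤ (true ∷ x) (false ∷ y) = s≤s (weight-⊕-≤ x y)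
weight-⊕-≤ (true ∷ x) (true ∷ y) =
  m≤n⇒m≤1+n (≤-trans (weight-⊕-≤ x y) (+-monoʳ-≤ (weight x) (n≤1+n (weight y))))

distance-triangle : ∀ {n} (x y z : Bits n) → weight (x ⊕ z) ≤ weight (x ⊕ y) + weight (y ⊕ z)
distance-triangle x y z = subst (λ v → weight v ≤ weight (x ⊕ y) + weight (y ⊕ z)) path (weight-⊕-≤ (x ⊕ y) (y ⊕ z))
  where
  path : (x ⊕ y) ⊕ (y ⊕ z) ≡ x ⊕ z
  path = trans (⊕-assoc x y (y ⊕ z)) (cong (x ⊕_) (⊕-cancelˡ y z))

distance-complement : ∀ {n} (x y : Bits n) → weight (x ⊕ y) + weight (x ⊕ (ones n ⊕ y)) ≡ n
distance-complement {n} x y =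
  trans (cong (λ z → weight (x ⊕ y) + weight z) (x∙yz≈y∙xz x (ones n) y)) (weight-complement (x ⊕ y))
  where open CommutativeSemigroupProperties (⊕-commutativeSemigroup n) using (x∙yz≈y∙xz)

⟨⟩-comm : ∀ {n} (s x : Bits n) → ⟨ s , x ⟩ ≡ ⟨ x , s ⟩
⟨⟩-comm [] [] = refl
⟨⟩-comm (a ∷ s) (b ∷ x) = cong₂ _xor_ (∧-comm a b) (⟨⟩-comm s x)

⟨⟩-zeroʳ : ∀ {n} (s : Bits n) → ⟨ s , zeros n ⟩ ≡ false
⟨⟩-zeroʳ [] = refl
⟨⟩-zeroʳ (false ∷ s) = ⟨⟩-zeroʳ s
⟨⟩-zeroʳ (true ∷ s) = ⟨⟩-zeroʳ s

⟨⟩-zeroˡ : ∀ {n} (x : Bits n) → ⟨ zeros n , x ⟩ ≡ false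
⟨⟩-zeroˡ [] = refl
⟨⟩-zeroˡ (b ∷ x) = ⟨⟩-zeroˡ x

⟨⟩-linearʳ : ∀ {n} (s x y : Bits n) → ⟨ s , x ⊕ y ⟩ ≡ ⟨ s , x ⟩ xor ⟨ s , y ⟩
⟨⟩-linearʳ [] [] [] = refl
⟨⟩-linearʳ (a ∷ s) (b ∷ x) (c ∷ y) = begin
  (a ∧ (b xor c)) xor ⟨ s , x ⊕ y ⟩
    ≡⟨ cong₂ _xor_ (∧-distribˡ-xor a b c) (⟨⟩-linearʳ s x y) ⟩
  ((a ∧ b) xor (a ∧ c)) xor (⟨ s , x ⟩ xor ⟨ s , y ⟩)
    ≡⟨ xor-interchange (a ∧ b) (a ∧ c) ⟨ s , x ⟩ ⟨ s , y ⟩ ⟩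
  ((a ∧ b) xor ⟨ s , x ⟩) xor ((a ∧ c) xor ⟨ s , y ⟩) ∎
  where open ≡-Reasoning

⟨⟩-linearˡ : ∀ {n} (s t x : Bits n) → ⟨ s ⊕ t , x ⟩ ≡ ⟨ s , x ⟩ xor ⟨ t , x ⟩
⟨⟩-linearˡ s t x =
  trans (⟨⟩-comm (s ⊕ t) x) (trans (⟨⟩-linearʳ x s t) (cong₂ _xor_ (⟨⟩-comm x s) (⟨⟩-comm x t)))

parity : ∀ {n} → Bits n → Bool
parity {n} x = ⟨ ones n , x ⟩

weight≤1⇒parity≡weight : ∀ {n} (e : Bits n) → weight e ≤ 1 → bitWeight (parity e) ≡ weight e
weight≤1⇒parity≡weight [] _ = refl
weight≤1⇒parity≡weight (false ∷ e) w = weight≤1⇒parity≡weight e w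
weight≤1⇒parity≡weight (true ∷ e) (s≤s w) with parity e | weight≤1⇒parity≡weight e (≤-trans w z≤n)
... | false | eq = cong suc eq
... | true | eq = contradiction (subst (_≤ 0) (sym eq) w) λ ()

-- The promise function

≤ᵇ-true : ∀ {m n} → m ≤ n → (m ≤ᵇ n) ≡ true
≤ᵇ-true = dec-true (_ ≤? _)

≤ᵇ-false : ∀ {m n} → ¬ m ≤ n → (m ≤ᵇ n) ≡ false
≤ᵇ-false = dec-false (_ ≤? _)

≡ᵇ-true : ∀ {m n} → m ≡ n → (m ≡ᵇ n) ≡ true
≡ᵇ-true = dec-true (_ ≟ _)

≡ᵇ-false : ∀ {m n} → m ≢ n → (m ≡ᵇ n) ≡ false
≡ᵇ-false = dec-false (_ ≟ _)

f≡false⇒light : ∀ n x → f n x ≡ just false → weight x ≤ n ∸ 3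
f≡false⇒light n x eq with weight x ≤? n ∸ 3
... | yes light = light
... | no heavy rewrite ≤ᵇ-false heavy with weight x ≡ᵇ n
...   | true = case eq of λ ()
...   | false = case eq of λ ()

f≡true⇒ones : ∀ n x → f n x ≡ just true → x ≡ ones n
f≡true⇒ones n x eq with weight x ≤? n ∸ 3
... | yes light rewrite ≤ᵇ-true light = case eq of λ ()
... | no heavy rewrite ≤ᵇ-false heavy with weight x ≟ n
...   | yes full = weight≡n⇒ones x full
...   | no partial rewrite ≡ᵇ-false partial = case eq of λ ()

light⇒f≡false : ∀ n x → weight x ≤ n ∸ 3 → f n x ≡ just false
light⇒f≡false n x light rewrite ≤ᵇ-true light = refl

full⇒f≡true : ∀ n x → 1 ≤ n → weight x ≡ n → f n x ≡ just true
full⇒f≡true (suc n) x _ full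
  rewrite full | ≤ᵇ-false {suc n} {n ∸ 2} (<⇒≱ (s≤s (m∸n≤m n 2))) | ≡ᵇ-true (refl {x = n}) = refl

f-ones : ∀ n → 1 ≤ n → f n (ones n) ≡ just true
f-ones n 1≤n = full⇒f≡true n (ones n) 1≤n (weight-ones n)

middle⇒f≡nothing : ∀ n x → n ∸ 3 < weight x → weight x < n → f n x ≡ nothing
middle⇒f≡nothing n x heavy partial rewrite ≤ᵇ-false (<⇒≱ heavy) | ≡ᵇ-false (<⇒≢ partial) = refl

-- Radius-1 covering codes

record CoveringCode (m t : ℕ) : Set where
  field
    compress : Bits m → Bits t
    decompress : Bits t → Bits m
    covers : ∀ x → weight (x ⊕ decompress (compress x)) ≤ 1

open CoveringCode

trivialCode : CoveringCode 0 0
trivialCode = record { compress = λ x → x ; decompress = λ x → x ; covers = λ { [] → z≤n } }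

extendCode : ∀ {m t} → CoveringCode m t → CoveringCode (suc m) (suc t)
extendCode code = record
  { compress = λ { (b ∷ x) → b ∷ compress code x }
  ; decompress = λ { (b ∷ i) → b ∷ decompress code i }
  ; covers = λ { (b ∷ x) → subst (λ c → bitWeight c + _ ≤ 1) (sym (xor-same b)) (covers code x) }
  }

padCode : ∀ k {m t} → CoveringCode m t → CoveringCode (k + m) (k + t)
padCode zero code = code
padCode (suc k) code = extendCode (padCode k code)

take-++ : ∀ {A : Set} m {k} (u : Vec A m) (w : Vec A k) → take m (u ++ w) ≡ u
take-++ m u w = ++-injectiveˡ (take m (u ++ w)) u (take++drop≡id m (u ++ w))

drop-++ : ∀ {A : Set} m {k} (u : Vec A m) (w : Vec A k) → drop m (u ++ w) ≡ w
drop-++ m u w = ++-injectiveʳ (take m (u ++ w)) u (take++drop≡id m (u ++ w))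

weight-∷-++ : ∀ {m k} z q (a u : Bits m) (b w : Bits k) →
  weight ((z ∷ (a ++ b)) ⊕ (q ∷ (u ++ w))) ≡ bitWeight (z xor q) + (weight (a ⊕ u) + weight (b ⊕ w))
weight-∷-++ z q a u b w =
  cong (bitWeight (z xor q) +_) (trans (cong weight (zipWith-++ _xor_ a b u w)) (weight-++ (a ⊕ u) (b ⊕ w)))

bitWeight-not : ∀ b → bitWeight (not b) + bitWeight b ≡ 1
bitWeight-not false = refl
bitWeight-not true = refl

-- The codewords are (parity u , u , u ⊕ c) for u ∈ Bits m and c an old codeword.
-- To cover (z , a , b) let c be the old codeword nearest to a ⊕ b and e its
-- residue, of weight ≤ 1. Take u = a when z = parity a; otherwise u = a ⊕ e, which
-- fixes the parity bit if e ≠ 0 and costs that one bit if e = 0.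
module HammingStep {m t} (code : CoveringCode m t) where

  residue : Bits m → Bits m
  residue s = s ⊕ decompress code (compress code s)

  correction : Bool → Bits m → Bits m
  correction σ e = if σ then e else zeros m

  correction-cost : ∀ σ e → weight e ≤ 1 →
    bitWeight (σ xor parity (correction σ e)) + (weight (correction σ e) + weight (e ⊕ correction σ e)) ≤ 1
  correction-cost false e light rewrite ⟨⟩-zeroʳ (ones m) | weight-zeros m | ⊕-identityʳ e = light
  correction-cost true e light rewrite ⊕-self e | weight-zeros m | +-identityʳ (weight e) = ≤-reflexive (begin
    bitWeight (not (parity e)) + weight e             ≡⟨ cong (bitWeight (not (parity e)) +_) (weight≤1⇒parity≡weight e light) ⟨
    bitWeight (not (parity e)) + bitWeight (parity e)  ≡⟨ bitWeight-not (parity e) ⟩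
    1                                                  ∎)
    where open ≡-Reasoning

  codeword : Bits m → Bits t → Bits (suc (m + m))
  codeword u i = parity u ∷ (u ++ (u ⊕ decompress code i))

  centre : Bool → Bits m → Bits m → Bits m
  centre z a b = a ⊕ correction (z xor parity a) (residue (a ⊕ b))

  stepCompress : Bits (suc (m + m)) → Bits (m + t)
  stepCompress (z ∷ v) = centre z (take m v) (drop m v) ++ compress code (take m v ⊕ drop m v)

  stepDecompress : Bits (m + t) → Bits (suc (m + m))
  stepDecompress w = codeword (take m w) (drop m w)

  stepCovers : ∀ x → weight (x ⊕ stepDecompress (stepCompress x)) ≤ 1
  stepCovers (z ∷ v) = begin
    weight ((z ∷ v) ⊕ codeword (take m (u ++ i)) (drop m (u ++ i)))
      ≡⟨ cong₂ (λ v′ w → weight ((z ∷ v′) ⊕ w))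
               (sym (take++drop≡id m v)) (cong₂ codeword (take-++ m u i) (drop-++ m u i)) ⟩
    weight ((z ∷ (a ++ b)) ⊕ codeword u i)
      ≡⟨ weight-∷-++ z (parity u) a u b (u ⊕ c) ⟩
    bitWeight (z xor parity u) + (weight (a ⊕ u) + weight (b ⊕ (u ⊕ c)))
      ≡⟨ cong₂ _+_ (cong bitWeight parity-u)
                   (cong₂ _+_ (cong weight (⊕-cancelˡ a d)) (cong weight (⊕-shift a b c d))) ⟩
    bitWeight (σ xor parity d) + (weight d + weight (e ⊕ d))
      ≤⟨ correction-cost σ e (covers code (a ⊕ b)) ⟩
    1 ∎
    where
    open ≤-Reasoning
    a = take m v
    b = drop m v
    σ = z xor parity a
    i = compress code (a ⊕ b)
    c = decompress code i
    e = residue (a ⊕ b)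
    d = correction σ e
    u = a ⊕ d
    parity-u : z xor parity u ≡ σ xor parity d
    parity-u = trans (cong (z xor_) (⟨⟩-linearʳ (ones m) a d)) (sym (xor-assoc z (parity a) (parity d)))

  hammingStep : CoveringCode (suc (m + m)) (m + t)
  hammingStep = record { compress = stepCompress ; decompress = stepDecompress ; covers = stepCovers }

hammingLength hammingDimension : ℕ → ℕ
hammingLength zero = 0
hammingLength (suc r) = suc (hammingLength r + hammingLength r)
hammingDimension zero = 0
hammingDimension (suc r) = hammingLength r + hammingDimension r

hammingCode : ∀ r → CoveringCode (hammingLength r) (hammingDimension r)
hammingCode zero = trivialCode
hammingCode (suc r) = HammingStep.hammingStep (hammingCode r)

hammingDimension+r≡hammingLength : ∀ r → hammingDimension r + r ≡ hammingLength r
hammingDimension+r≡hammingLength zero = refl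
hammingDimension+r≡hammingLength (suc r) = begin
  (hammingLength r + hammingDimension r) + suc r  ≡⟨ +-suc _ r ⟩
  suc ((hammingLength r + hammingDimension r) + r) ≡⟨ cong suc (+-assoc (hammingLength r) _ r) ⟩
  suc (hammingLength r + (hammingDimension r + r))
    ≡⟨ cong (λ k → suc (hammingLength r + k)) (hammingDimension+r≡hammingLength r) ⟩
  suc (hammingLength r + hammingLength r)          ∎
  where open ≡-Reasoning

1+hammingLength≡2^r : ∀ r → suc (hammingLength r) ≡ 2 ^ r
1+hammingLength≡2^r zero = refl
1+hammingLength≡2^r (suc r) = begin
  suc (suc (hammingLength r + hammingLength r)) ≡⟨ cong suc (+-suc (hammingLength r) (hammingLength r)) ⟨
  suc (hammingLength r) + suc (hammingLength r) ≡⟨ cong₂ _+_ (1+hammingLength≡2^r r) (1+hammingLength≡2^r r) ⟩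
  2 ^ r + 2 ^ r                                  ≡⟨ cong (2 ^ r +_) (+-identityʳ (2 ^ r)) ⟨
  2 ^ suc r                                      ∎
  where open ≡-Reasoning

2^⌊log2⌋≤n : ∀ n (acc : Acc _<_ n) → 1 ≤ n → 2 ^ ⌊log2⌋ n acc ≤ n
2^⌊log2⌋≤n 1 _ _ = ≤-refl
2^⌊log2⌋≤n (suc (suc n)) (acc rs) _ = begin
  2 * 2 ^ ⌊log2⌋ (suc ⌊ n /2⌋) _  ≤⟨ *-monoʳ-≤ 2 (2^⌊log2⌋≤n (suc ⌊ n /2⌋) _ (s≤s z≤n)) ⟩
  2 * suc ⌊ n /2⌋                 ≡⟨ cong suc (+-suc ⌊ n /2⌋ (⌊ n /2⌋ + 0)) ⟩
  2 + (⌊ n /2⌋ + (⌊ n /2⌋ + 0))     ≡⟨ cong (λ k → 2 + (⌊ n /2⌋ + k)) (+-identityʳ ⌊ n /2⌋) ⟩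
  2 + (⌊ n /2⌋ + ⌊ n /2⌋)          ≤⟨ +-monoʳ-≤ 2 (+-monoʳ-≤ ⌊ n /2⌋ (⌊n/2⌋≤⌈n/2⌉ n)) ⟩
  2 + (⌊ n /2⌋ + ⌈ n /2⌉)          ≡⟨ cong (2 +_) (⌊n/2⌋+⌈n/2⌉≡n n) ⟩
  suc (suc n)                     ∎
  where open ≤-Reasoning

logCoveringCode : ∀ n → 1 ≤ n → Σ ℕ λ t → CoveringCode n t × t + ⌊log₂ n ⌋ ≡ n
logCoveringCode n 1≤n =
  k + hammingDimension r , subst (λ l → CoveringCode l (k + hammingDimension r)) k+length≡n (padCode k (hammingCode r)) ,
  trans (+-assoc k _ r) (trans (cong (k +_) (hammingDimension+r≡hammingLength r)) k+length≡n)
  where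
  r = ⌊log₂ n ⌋
  length≤n : hammingLength r ≤ n
  length≤n = ≤-trans (n≤1+n _) (subst (_≤ n) (sym (1+hammingLength≡2^r r)) (2^⌊log2⌋≤n n _ 1≤n))
  k = n ∸ hammingLength r
  k+length≡n : k + hammingLength r ≡ n
  k+length≡n = m∸n+n≡m length≤n

-- One-way protocols

n∸3+2<n : ∀ {n} → 3 ≤ n → n ∸ 3 + 2 < n
n∸3+2<n {suc (suc (suc k))} (s≤s (s≤s (s≤s _))) = subst (_< 3 + k) (+-comm 2 k) ≤-refl

Separating : ∀ {n t} → (Bits n → Bits t) → Set
Separating {n} h = ∀ x y → f n (x ⊕ y) ≡ just false → h x ≢ h (ones n ⊕ y)

protocol⇒separating : ∀ {n t} → 1 ≤ n → (P : OneWayProtocol (F n) t) → Separating (proj₁ P)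
protocol⇒separating {n} 1≤n (h , φ , correct) x y light same = case accepts of λ ()
  where
  complement-accepted : f n ((ones n ⊕ y) ⊕ y) ≡ just true
  complement-accepted = subst (λ z → f n z ≡ just true) (sym (⊕-cancelʳ (ones n) y)) (f-ones n 1≤n)
  accepts : false ≡ true
  accepts = begin
    false                   ≡⟨ correct x y false light ⟨
    φ (h x) y               ≡⟨ cong (λ c → φ c y) same ⟩
    φ (h (ones n ⊕ y)) y    ≡⟨ correct (ones n ⊕ y) y true complement-accepted ⟩
    true                    ∎
    where open ≡-Reasoning

separating⇒protocol : ∀ {n t} {h : Bits n → Bits t} → Separating h → OneWayProtocol (F n) t
separating⇒protocol {n} {h = h} separating = h , (λ c y → does (h (ones n ⊕ y) ≟ᴮ c)) , correct
  where
  correct : ∀ x y b → F n x y ≡ just b → does (h (ones n ⊕ y) ≟ᴮ h x) ≡ b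
  correct x y true full = dec-true (_ ≟ᴮ _) (cong h (sym (⊕-complement x y (f≡true⇒ones n (x ⊕ y) full))))
  correct x y false light = dec-false (_ ≟ᴮ _) (λ same → separating x y light (sym same))

covering⇒separating : ∀ {n t} → 3 ≤ n → (code : CoveringCode n t) → Separating (compress code)
covering⇒separating {n} 3≤n code x y light same = <-irrefl refl (begin-strict
  n                                         ≡⟨ distance-complement x y ⟨
  weight (x ⊕ y) + weight (x ⊕ x̄)           ≤⟨ +-mono-≤ (f≡false⇒light n (x ⊕ y) light) close ⟩
  n ∸ 3 + 2                                 <⟨ n∸3+2<n 3≤n ⟩
  n                                         ∎)
  where
  open ≤-Reasoning
  x̄ = ones n ⊕ y
  c = decompress code (compress code x)
  close : weight (x ⊕ x̄) ≤ 2
  close = ≤-trans (distance-triangle x c x̄)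
    (+-mono-≤ (covers code x) (subst (λ v → weight v ≤ 1) (⊕-comm x̄ c)
      (subst (λ i → weight (x̄ ⊕ decompress code i) ≤ 1) (sym same) (covers code x̄))))

Searchable : Set → Set₁
Searchable A = ∀ {P : A → Set} → Decidable P → Dec (∃ P)

∀-dec : ∀ {A} {P : A → Set} → Searchable A → Decidable P → Dec (∀ a → P a)
∀-dec search P? with search (λ a → ¬? (P? a))
... | yes (a , ¬pa) = no (λ all → ¬pa (all a))
... | no none = yes (λ a → decidable-stable (P? a) (λ ¬pa → none (a , ¬pa)))

searchable-Bits : ∀ n → Searchable (Bits n)
searchable-Bits zero P? = map′ ([] ,_) (λ { ([] , p) → p }) (P? [])
searchable-Bits (suc n) P? =
  map′ (λ { (inj₁ (x , p)) → false ∷ x , p ; (inj₂ (x , p)) → true ∷ x , p })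
       (λ { (false ∷ x , p) → inj₁ (x , p) ; (true ∷ x , p) → inj₂ (x , p) })
       (searchable-Bits n (λ x → P? (false ∷ x)) ⊎-dec searchable-Bits n (λ x → P? (true ∷ x)))

-- Without function extensionality, a search over Bits n → B can only decide
-- predicates that respect pointwise equality.
Extensional : ∀ {n} {B : Set} → ((Bits n → B) → Set) → Set
Extensional P = ∀ {h h′} → h ≗ h′ → P h → P h′

cases : ∀ {n} {B : Set} → (Bits n → B) → (Bits n → B) → Bits (suc n) → B
cases g k (false ∷ x) = g x
cases g k (true ∷ x) = k x

search-Bits→ : ∀ n {B} → Searchable B → ∀ {P : (Bits n → B) → Set} → Extensional P → Decidable P → Dec (∃ P)
search-Bits→ zero search resp P? =
  map′ (λ (b , p) → (λ _ → b) , p) (λ (h , p) → h [] , resp (λ { [] → refl }) p) (search (λ b → P? (λ _ → b)))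
search-Bits→ (suc n) search {P} resp P? =
  map′ (λ (g , k , p) → cases g k , p)
       (λ (h , p) → (λ x → h (false ∷ x)) , (λ x → h (true ∷ x)) ,
                    resp (λ { (false ∷ x) → refl ; (true ∷ x) → refl }) p)
       (search-Bits→ n search resp-outer λ g → search-Bits→ n search (resp-inner g) λ k → P? (cases g k))
  where
  resp-inner : ∀ g → Extensional (λ k → P (cases g k))
  resp-inner g k≗k′ = resp (λ { (false ∷ x) → refl ; (true ∷ x) → k≗k′ x })
  resp-outer : Extensional (λ g → ∃ λ k → P (cases g k))
  resp-outer g≗g′ (k , p) = k , resp (λ { (false ∷ x) → g≗g′ x ; (true ∷ x) → refl }) p

IsLeast : (ℕ → Set) → ℕ → Set
IsLeast P d = P d × (∀ t → P t → d ≤ t)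

least : ∀ {P : ℕ → Set} → Decidable P → ∀ N → P N → ∃ (IsLeast P)
least {P} P? = <-rec (λ N → P N → ∃ (IsLeast P)) step
  where
  step : ∀ N → (∀ {M} → M < N → P M → ∃ (IsLeast P)) → P N → ∃ (IsLeast P)
  step N smaller pN with anyUpTo? P? N
  ... | yes (M , M<N , pM) = smaller M<N pM
  ... | no none = N , pN , λ t pt → ≮⇒≥ (λ t<N → none (t , t<N , pt))

separating-extensional : ∀ {n t} → Extensional (Separating {n} {t})
separating-extensional h≗h′ separating x y light same =
  separating x y light (trans (h≗h′ x) (trans same (sym (h≗h′ _))))

separating? : ∀ {n t} → Decidable (Separating {n} {t})
separating? {n} h =
  ∀-dec (searchable-Bits n) λ x → ∀-dec (searchable-Bits n) λ y →
    (f n (x ⊕ y) ≟ᴹ just false) →-dec ¬? (h x ≟ᴮ h (ones n ⊕ y))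
  where _≟ᴹ_ = Maybe.≡-dec Bool._≟_

protocol? : ∀ {n} → 1 ≤ n → Decidable (OneWayProtocol (F n))
protocol? {n} 1≤n t =
  map′ (λ (h , separating) → separating⇒protocol separating) (λ P → proj₁ P , protocol⇒separating 1≤n P)
       (search-Bits→ n (searchable-Bits t) separating-extensional separating?)

dcc-bound : ∀ n → 3 ≤ n → Σ ℕ λ d → IsDcc (F n) d × (d + ⌊log₂ n ⌋ ≤ n)
dcc-bound n 3≤n =
  let t , code , t+log≡n = logCoveringCode n 1≤n
      protocol = separating⇒protocol (covering⇒separating 3≤n code)
      d , isDcc = least (protocol? 1≤n) t protocol
  in d , isDcc , ≤-trans (+-monoˡ-≤ ⌊log₂ n ⌋ (proj₂ isDcc t protocol)) (≤-reflexive t+log≡n)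
  where 1≤n = ≤-trans (s≤s z≤n) 3≤n

-- Non-adaptive parity decision trees

Orthogonal : ∀ {n} → Bits n → Bits n → Set
Orthogonal y s = ⟨ s , y ⟩ ≡ false

pivot : ∀ {n} (L : List (Bits (suc n))) →
  All (λ s → head s ≡ false) L ⊎ Σ (Bits n) λ t → Σ (List (Bits (suc n))) λ R → (true ∷ t) ∷ R ↭ L
pivot [] = inj₁ []
pivot ((true ∷ t) ∷ L) = inj₂ (t , L , ↭-refl)
pivot ((false ∷ s) ∷ L) with pivot L
... | inj₁ heads = inj₁ (refl ∷ heads)
... | inj₂ (t , R , perm) = inj₂ (t , (false ∷ s) ∷ R , ↭-trans (↭-swap _ _ ↭-refl) (↭-prep _ perm))

eliminate : ∀ {n} → Bits n → Bits (suc n) → Bits n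
eliminate t (false ∷ s) = s
eliminate t (true ∷ s) = s ⊕ t

free-orthogonal : ∀ {n} c (y : Bits n) (s : Bits (suc n)) → head s ≡ false → Orthogonal y (tail s) → Orthogonal (c ∷ y) s
free-orthogonal c y (false ∷ s) refl o = o

eliminate-orthogonal : ∀ {n} (t y : Bits n) s → Orthogonal y (eliminate t s) → Orthogonal (⟨ t , y ⟩ ∷ y) s
eliminate-orthogonal t y (false ∷ s) o = o
eliminate-orthogonal t y (true ∷ s) o = trans (xor-comm ⟨ t , y ⟩ ⟨ s , y ⟩) (trans (sym (⟨⟩-linearˡ s t y)) o)

-- Gaussian elimination on the first coordinate: it is either free (set it to 1) or pivotal.
heavy-solution : ∀ n k (L : List (Bits n)) → length L + k ≤ n → Σ (Bits n) λ y → All (Orthogonal y) L × k ≤ weight y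
heavy-solution n zero L _ = zeros n , All.universal ⟨⟩-zeroʳ L , z≤n
heavy-solution zero (suc k) L room = case subst (_≤ 0) (+-suc (length L) k) room of λ ()
heavy-solution (suc n) (suc k) L room with pivot L
... | inj₁ heads =
  let y , orth , heavy = heavy-solution n k (List.map tail L) room′
  in true ∷ y , All.zipWith (λ {s} (h , o) → free-orthogonal true y s h o) (heads , map⁻ orth) , s≤s heavy
  where
  room′ : length (List.map tail L) + k ≤ n
  room′ rewrite List.length-map tail L = s≤s⁻¹ (subst (_≤ suc n) (+-suc (length L) k) room)
... | inj₂ (t , R , perm) =
  let y , orth , heavy = heavy-solution n (suc k) (List.map (eliminate t) R) room′
  in ⟨ t , y ⟩ ∷ y ,
     All-resp-↭ perm (xor-same ⟨ t , y ⟩ ∷ All.map (λ {s} → eliminate-orthogonal t y s) (map⁻ orth)) ,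
     ≤-trans heavy (m≤n+m (weight y) _)
  where
  room′ : length (List.map (eliminate t) R) + suc k ≤ n
  room′ rewrite List.length-map (eliminate t) R = s≤s⁻¹ (subst (λ l → l + suc k ≤ suc n) (sym (↭-length perm)) room)

queries-agree : ∀ {n q} (y : Bits n) (ss : Vec (Bits n) q) → All (Orthogonal y) (toList ss) →
  Vec.map (λ s → ⟨ s , ones n ⊕ y ⟩) ss ≡ Vec.map (λ s → ⟨ s , ones n ⟩) ss
queries-agree y [] [] = refl
queries-agree {n} y (s ∷ ss) (o ∷ os) =
  cong₂ _∷_ (trans (⟨⟩-linearʳ s (ones n) y) (trans (cong (⟨ s , ones n ⟩ xor_) o) (xor-identityʳ _)))
            (queries-agree y ss os)

q<n∸2⇒q+3≤n : ∀ {q n} → 2 ≤ n → q < n ∸ 2 → q + 3 ≤ n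
q<n∸2⇒q+3≤n {q} {n} 2≤n q<n∸2 = begin
  q + 3      ≡⟨ +-suc q 2 ⟩
  suc q + 2  ≤⟨ +-monoˡ-≤ 2 q<n∸2 ⟩
  n ∸ 2 + 2  ≡⟨ m∸n+n≡m 2≤n ⟩
  n          ∎
  where open ≤-Reasoning

nadt-lower : ∀ n → 3 ≤ n → ∀ q → NAParityDT (f n) q → n ∸ 2 ≤ q
nadt-lower n 3≤n q (ss , l , correct) = ≮⇒≥ λ q<n∸2 → case confused q<n∸2 of λ ()
  where
  open ≡-Reasoning
  confused : q < n ∸ 2 → false ≡ true
  confused q<n∸2 = begin
    false                                        ≡⟨ correct (ones n ⊕ y) false (light⇒f≡false n (ones n ⊕ y) light) ⟨
    l (Vec.map (λ s → ⟨ s , ones n ⊕ y ⟩) ss)   ≡⟨ cong l (queries-agree y ss orth) ⟩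
    l (Vec.map (λ s → ⟨ s , ones n ⟩) ss)       ≡⟨ correct (ones n) true (f-ones n (≤-trans (s≤s z≤n) 3≤n)) ⟩
    true                                         ∎
    where
    room : length (toList ss) + 3 ≤ n
    room = subst (λ p → p + 3 ≤ n) (sym (Vec.length-toList ss)) (q<n∸2⇒q+3≤n (≤-trans (s≤s (s≤s z≤n)) 3≤n) q<n∸2)
    solution = heavy-solution n 3 (toList ss) room
    y = proj₁ solution
    orth = proj₁ (proj₂ solution)
    light : weight (ones n ⊕ y) ≤ n ∸ 3
    light = subst (_≤ n ∸ 3)
                  (trans (cong (_∸ weight y) (sym (weight-complement y))) (m+n∸m≡n (weight y) (weight (ones n ⊕ y))))
                  (∸-monoʳ-≤ n (proj₂ (proj₂ solution)))

basis : ∀ n → Vec (Bits n) n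
basis zero = []
basis (suc n) = (true ∷ zeros n) ∷ Vec.map (false ∷_) (basis n)

read-basis : ∀ {n} (x : Bits n) → Vec.map (λ s → ⟨ s , x ⟩) (basis n) ≡ x
read-basis [] = refl
read-basis {suc n} (b ∷ x) =
  cong₂ _∷_ (trans (cong (b xor_) (⟨⟩-zeroˡ x)) (xor-identityʳ b)) (trans (sym (Vec.map-∘ _ _ (basis n))) (read-basis x))

read-padded-basis : ∀ {n} a₁ a₂ (x : Bits n) →
  Vec.map (λ s → ⟨ s , a₁ ∷ a₂ ∷ x ⟩) (Vec.map (λ s → false ∷ false ∷ s) (basis n)) ≡ x
read-padded-basis a₁ a₂ x = trans (sym (Vec.map-∘ _ _ (basis _))) (read-basis x)

nadt-upper : ∀ k → NAParityDT (f (3 + k)) (suc k)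
nadt-upper k = Vec.map (λ s → false ∷ false ∷ s) (basis (suc k)) , (λ v → does (v ≟ᴮ ones (suc k))) , correct
  where
  correct : ∀ x b → f (3 + k) x ≡ just b →
    does (Vec.map (λ s → ⟨ s , x ⟩) (Vec.map (λ s → false ∷ false ∷ s) (basis (suc k))) ≟ᴮ ones (suc k)) ≡ b
  correct (a₁ ∷ a₂ ∷ x) b eq = trans (cong (λ v → does (v ≟ᴮ ones (suc k))) (read-padded-basis a₁ a₂ x)) (decide b eq)
    where
    decide : ∀ b → f (3 + k) (a₁ ∷ a₂ ∷ x) ≡ just b → does (x ≟ᴮ ones (suc k)) ≡ b
    decide true eq =
      dec-true (x ≟ᴮ ones (suc k)) (Vec.∷-injectiveʳ (Vec.∷-injectiveʳ (f≡true⇒ones (3 + k) (a₁ ∷ a₂ ∷ x) eq)))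
    decide false eq =
      dec-false (x ≟ᴮ ones (suc k)) λ { refl → 1+n≰n (≤-trans heavy (f≡false⇒light (3 + k) (a₁ ∷ a₂ ∷ x) eq)) }
      where
      heavy : suc k ≤ weight (a₁ ∷ a₂ ∷ ones (suc k))
      heavy = ≤-trans (≤-reflexive (sym (weight-ones (suc k))))
                      (≤-trans (m≤n+m _ (bitWeight a₂)) (m≤n+m _ (bitWeight a₁)))

nadt : ∀ n → 3 ≤ n → IsNADT (f n) (n ∸ 2)
nadt (suc (suc (suc k))) 3≤n@(s≤s (s≤s (s≤s _))) = nadt-upper k , nadt-lower (3 + k) 3≤n

-- Counting undefined inputs

countBits : ∀ n → (Bits n → Bool) → ℕ
countBits n p = length (List.filter (λ x → T? (p x)) (allBits n))

length-filter-map : ∀ {A B : Set} (p : B → Bool) (g : A → B) xs →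
  length (List.filter (λ y → T? (p y)) (List.map g xs)) ≡ length (List.filter (λ x → T? (p (g x))) xs)
length-filter-map p g [] = refl
length-filter-map p g (x ∷ xs) with p (g x)
... | true = cong suc (length-filter-map p g xs)
... | false = length-filter-map p g xs

countBits-suc : ∀ n (p : Bits (suc n) → Bool) →
  countBits (suc n) p ≡ countBits n (λ x → p (false ∷ x)) + countBits n (λ x → p (true ∷ x))
countBits-suc n p = begin
  length (List.filter P? (List.map (false ∷_) (allBits n) List.++ List.map (true ∷_) (allBits n)))
    ≡⟨ cong length (List.filter-++ P? (List.map (false ∷_) (allBits n)) _) ⟩
  length (List.filter P? (List.map (false ∷_) (allBits n)) List.++ List.filter P? (List.map (true ∷_) (allBits n)))
    ≡⟨ List.length-++ (List.filter P? (List.map (false ∷_) (allBits n))) ⟩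
  length (List.filter P? (List.map (false ∷_) (allBits n))) + length (List.filter P? (List.map (true ∷_) (allBits n)))
    ≡⟨ cong₂ _+_ (length-filter-map p (false ∷_) (allBits n)) (length-filter-map p (true ∷_) (allBits n)) ⟩
  countBits n (λ x → p (false ∷ x)) + countBits n (λ x → p (true ∷ x)) ∎
  where
  open ≡-Reasoning
  P? = λ x → T? (p x)

countBits-cong : ∀ n {p q : Bits n → Bool} → (∀ x → p x ≡ q x) → countBits n p ≡ countBits n q
countBits-cong zero {p} {q} eq with p [] | q [] | eq []
... | true | .true | refl = refl
... | false | .false | refl = refl
countBits-cong (suc n) {p} {q} eq = begin
  countBits (suc n) p
    ≡⟨ countBits-suc n p ⟩
  countBits n (λ x → p (false ∷ x)) + countBits n (λ x → p (true ∷ x))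
    ≡⟨ cong₂ _+_ (countBits-cong n (λ x → eq (false ∷ x))) (countBits-cong n (λ x → eq (true ∷ x))) ⟩
  countBits n (λ x → q (false ∷ x)) + countBits n (λ x → q (true ∷ x))
    ≡⟨ countBits-suc n q ⟨
  countBits (suc n) q ∎
  where open ≡-Reasoning

countBits-false : ∀ n → countBits n (λ _ → false) ≡ 0
countBits-false zero = refl
countBits-false (suc n) = trans (countBits-suc n (λ _ → false)) (cong₂ _+_ (countBits-false n) (countBits-false n))

countBits-∨ : ∀ n (p q : Bits n → Bool) → (∀ x → T (p x) → T (q x) → ⊥) →
  countBits n (λ x → p x ∨ q x) ≡ countBits n p + countBits n q
countBits-∨ zero p q disjoint with p [] | q [] | disjoint []
... | true | true | both = ⊥-elim (both _ _)
... | true | false | _ = refl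
... | false | true | _ = refl
... | false | false | _ = refl
countBits-∨ (suc n) p q disjoint = begin
  countBits (suc n) (λ x → p x ∨ q x)
    ≡⟨ countBits-suc n (λ x → p x ∨ q x) ⟩
  countBits n (λ x → p₀ x ∨ q₀ x) + countBits n (λ x → p₁ x ∨ q₁ x)
    ≡⟨ cong₂ _+_ (countBits-∨ n p₀ q₀ (λ x → disjoint (false ∷ x)))
                 (countBits-∨ n p₁ q₁ (λ x → disjoint (true ∷ x))) ⟩
  (countBits n p₀ + countBits n q₀) + (countBits n p₁ + countBits n q₁)
    ≡⟨ +-interchange (countBits n p₀) (countBits n q₀) (countBits n p₁) (countBits n q₁) ⟩
  (countBits n p₀ + countBits n p₁) + (countBits n q₀ + countBits n q₁)
    ≡⟨ cong₂ _+_ (countBits-suc n p) (countBits-suc n q) ⟨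
  countBits (suc n) p + countBits (suc n) q ∎
  where
  open ≡-Reasoning
  open CommutativeSemigroupProperties +-commutativeSemigroup using () renaming (interchange to +-interchange)
  p₀ p₁ q₀ q₁ : Bits n → Bool
  p₀ x = p (false ∷ x)
  p₁ x = p (true ∷ x)
  q₀ x = q (false ∷ x)
  q₁ x = q (true ∷ x)

zeroCount : ∀ {n} → Bits n → ℕ
zeroCount {n} x = weight (ones n ⊕ x)

zeroCount+weight : ∀ {n} (x : Bits n) → zeroCount x + weight x ≡ n
zeroCount+weight x = trans (+-comm (zeroCount x) (weight x)) (weight-complement x)

countBits-zeroCount : ∀ n j → countBits n (λ x → zeroCount x ≡ᵇ j) ≡ n C j
countBits-zeroCount zero zero = refl
countBits-zeroCount zero (suc j) = refl
countBits-zeroCount (suc n) zero =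
  trans (countBits-suc n (λ x → zeroCount x ≡ᵇ 0)) (cong₂ _+_ (countBits-false n) (countBits-zeroCount n 0))
countBits-zeroCount (suc n) (suc j) =
  trans (countBits-suc n (λ x → zeroCount x ≡ᵇ suc j))
        (trans (cong₂ _+_ (countBits-zeroCount n j) (countBits-zeroCount n (suc j))) (nCk+nC[k+1]≡[n+1]C[k+1] n j))

f-undefined : ∀ n → 3 ≤ n → ∀ x → is-nothing (f n x) ≡ (zeroCount x ≡ᵇ 1) ∨ (zeroCount x ≡ᵇ 2)
f-undefined n@(suc (suc (suc k))) (s≤s (s≤s (s≤s _))) x with zeroCount x | zeroCount+weight x
... | zero | full = cong is-nothing (full⇒f≡true n x (s≤s z≤n) full)
... | suc zero | eq =
  cong is-nothing (middle⇒f≡nothing n x (subst (k <_) (sym w≡) (s≤s (n≤1+n k))) (subst (_< n) (sym w≡) ≤-refl))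
  where w≡ = suc-injective eq
... | suc (suc zero) | eq =
  cong is-nothing (middle⇒f≡nothing n x (subst (k <_) (sym w≡) ≤-refl) (subst (_< n) (sym w≡) (n≤1+n _)))
  where w≡ = suc-injective (suc-injective eq)
... | suc (suc (suc j)) | eq =
  cong is-nothing (light⇒f≡false n x (subst (weight x ≤_) (suc-injective (suc-injective (suc-injective eq))) (m≤n+m (weight x) j)))

[1+n]C2 : ∀ n → 1 ≤ n → suc n C 2 ≡ (n * suc n) / 2
[1+n]C2 n@(suc _) _ = trans (nCk≡nPk/k! {2} {suc n} (s≤s (s≤s z≤n))) (cong (λ k → (n * k) / 2) (*-identityʳ (suc n)))

undefCount-f : ∀ n → 3 ≤ n → undefCount (f n) ≡ (n * suc n) / 2
undefCount-f n 3≤n = begin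
  countBits n (λ x → is-nothing (f n x))
    ≡⟨ countBits-cong n (f-undefined n 3≤n) ⟩
  countBits n (λ x → (zeroCount x ≡ᵇ 1) ∨ (zeroCount x ≡ᵇ 2))
    ≡⟨ countBits-∨ n _ _ disjoint ⟩
  countBits n (λ x → zeroCount x ≡ᵇ 1) + countBits n (λ x → zeroCount x ≡ᵇ 2)
    ≡⟨ cong₂ _+_ (countBits-zeroCount n 1) (countBits-zeroCount n 2) ⟩
  n C 1 + n C 2
    ≡⟨ nCk+nC[k+1]≡[n+1]C[k+1] n 1 ⟩
  suc n C 2
    ≡⟨ [1+n]C2 n (≤-trans (s≤s z≤n) 3≤n) ⟩
  (n * suc n) / 2 ∎
  where
  open ≡-Reasoning
  disjoint : ∀ (x : Bits n) → T (zeroCount x ≡ᵇ 1) → T (zeroCount x ≡ᵇ 2) → ⊥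
  disjoint x one two = subst (λ z → T (z ≡ᵇ 2)) (≡ᵇ⇒≡ (zeroCount x) 1 one) two

⌊log₂⌋-isΘlog : IsΘlog ⌊log₂_⌋
⌊log₂⌋-isΘlog = 1 , 1 , 0 , λ n _ → ≤-reflexive (sym (*-identityˡ _)) , ≤-reflexive (sym (*-identityˡ _))

theorem35 : (Σ (ℕ → ℕ) λ g → IsΘlog g ×
    (∀ n → 3 ≤ n → Σ ℕ λ d → IsDcc (F n) d × (d + g n ≤ n)))
    × (∀ n → 3 ≤ n → IsNADT (f n) (n ∸ 2))
    × (∀ n → 3 ≤ n → undefCount (f n) ≡ (n * suc n) / 2)
theorem35 = (⌊log₂_⌋ , ⌊log₂⌋-isΘlog , dcc-bound) , nadt , undefCount-f
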